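{- Let $m,i$ be natural numbers with $0<m\le i$, and let $cs,us,ds$ be terms. Consider the conditions (A) $(cs,[t|us],ds)$ is correct up to $m$ w.r.t. $i$; (B) $(cs,us,[t'|ds])$ is correct up to $m$ w.r.t. $i+1$. Then for any ground terms $t,t'\in\mathcal{HU}$, (A) implies (B). Moreover, for any ground term $t'\in\mathcal{HU}$, (B) implies that there exists a ground term $t\in\mathcal{HU}$ such that (A) holds.
   Context: $\mathcal{HU}$ is the set of ground terms over a fixed alphabet containing $0$, $s$, and the list constructors; $\mathcal{TU}$ is the set of all terms. A natural number $j$ is identified with the term $s^j(0)$. Prolog list notation: $[e_1,\dots,e_n|e]$ stands for $e$ when $n=0$; $[e_1,\dots,e_n]$ is a list with members $e_1,\dots,e_n$. Generalized membership: a term $e$ is the $k$-th member ($k>0$) of a term $t$ if $t=[e_1,\dots,e_{k-1},e|e']$ for some terms $e_1,\dots,e_{k-1},e'$; $e$ is a member of $t$ if it is its $k$-th member for some $k>0$. A list of distinct members is a list $[e_1,\dots,e_n]$ with pairwise distinct $e_a$. Diagonal numbers: if a number $j$ is the $k$-th member of a list $cs$ (of distinct members), the up-diagonal number of $j$ w.r.t. $i$ in $cs$ is the integer $k+j-i$, and the down-diagonal number of $j$ w.r.t. $i$ in $cs$ is $k+i-j$. Correct triple: a triple $(cs,us,ds)\in\mathcal{TU}^3$ is correct up to $m$ w.r.t. $i$ when $0\le m\le i$ and: $cs$ is a list of distinct members and each $j\in\{1,\dots,m\}$ is a member of $cs$; the up-diagonal numbers (w.r.t. $i$ in $cs$) of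 $1,\dots,m$ are pairwise distinct, and the down-diagonal numbers of $1,\dots,m$ are pairwise distinct; and for each $j\in\{1,\dots,m\}$, if the up-diagonal number of $j$ w.r.t. $i$ in $cs$ is $l>0$ then the $l$-th member of $us$ is $j$, and if the down-diagonal number of $j$ w.r.t. $i$ in $cs$ is $l>0$ then the $l$-th member of $ds$ is $j$. -}

module Defs where

open import Data.Nat using (ℕ; zero; suc; _≤_; _<_)
open import Data.Integer as ℤ using (ℤ; +_)
open import Data.List using (List; []; _∷_)
open import Data.List.Relation.Unary.All using (All)
open import Data.List.Relation.Unary.Unique.Propositional using (Unique)
open import Data.Product using (Σ; ∃; _×_)
open import Relation.Binary.PropositionalEquality using (_≡_; _≢_)

-- Terms over an alphabet containing 0, s, [] and [_|_], plus arbitrary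
-- further function symbols drawn from F (each applied to a list of args),
-- and variables (named by naturals).  TU = Term F.
data Term (F : Set) : Set where
  var  : ℕ → Term F
  zro  : Term F
  sc   : Term F → Term F
  nil  : Term F
  cons : Term F → Term F → Term F
  app  : F → List (Term F) → Term F

data Ground {F : Set} : Term F → Set where
  g-zro  : Ground zro
  g-sc   : ∀ {t} → Ground t → Ground (sc t)
  g-nil  : Ground nil
  g-cons : ∀ {t u} → Ground t → Ground u → Ground (cons t u)
  g-app  : ∀ {f ts} → All Ground ts → Ground (app f ts)

num : {F : Set} → ℕ → Term F
num zero    = zro
num (suc j) = sc (num j)

data KthMember {F : Set} : ℕ → Term F → Term F → Set where
  here  : ∀ {e t} → KthMember 1 e (cons e t)
  there : ∀ {k e x t} → KthMember k e t → KthMember (suc k) e (cons x t)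

Member : {F : Set} → Term F → Term F → Set
Member e t = ∃ λ k → KthMember k e t

data IsListOf {F : Set} : Term F → List (Term F) → Set where
  lnil  : IsListOf nil []
  lcons : ∀ {e t es} → IsListOf t es → IsListOf (cons e t) (e ∷ es)

DistinctList : {F : Set} → Term F → Set
DistinctList {F} t = Σ (List (Term F)) λ es → IsListOf t es × Unique es

upDiag : ℕ → ℕ → ℕ → ℤ
upDiag k j i = (+ k ℤ.+ + j) ℤ.- + i

downDiag : ℕ → ℕ → ℕ → ℤ
downDiag k j i = (+ k ℤ.+ + i) ℤ.- + j

record Correct {F : Set} (m i : ℕ) (cs us ds : Term F) : Set where
  field
    m≤i      : m ≤ i
    distinct : DistinctList cs
    members  : ∀ j → 1 ≤ j → j ≤ m → Member (num j) cs
    upDistinct : ∀ j₁ j₂ k₁ k₂ → 1 ≤ j₁ → j₁ ≤ m → 1 ≤ j₂ → j₂ ≤ m → j₁ ≢ j₂ →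
                 KthMember k₁ (num j₁) cs → KthMember k₂ (num j₂) cs →
                 upDiag k₁ j₁ i ≢ upDiag k₂ j₂ i
    downDistinct : ∀ j₁ j₂ k₁ k₂ → 1 ≤ j₁ → j₁ ≤ m → 1 ≤ j₂ → j₂ ≤ m → j₁ ≢ j₂ →
                 KthMember k₁ (num j₁) cs → KthMember k₂ (num j₂) cs →
                 downDiag k₁ j₁ i ≢ downDiag k₂ j₂ i
    upPlaced : ∀ j k l → 1 ≤ j → j ≤ m → KthMember k (num j) cs →
               0 < l → + l ≡ upDiag k j i → KthMember l (num j) us
    downPlaced : ∀ j k l → 1 ≤ j → j ≤ m → KthMember k (num j) cs →
               0 < l → + l ≡ downDiag k j i → KthMember l (num j) ds

-- Passing from i to i + 1 lowers every up-diagonal number by one and raises every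
-- down-diagonal number by one.  Distinctness of diagonal numbers is therefore
-- unaffected, the up-diagonal list loses its head and the down-diagonal list gains
-- one.  The new head of ds could only be claimed by a j with down-diagonal number 0
-- w.r.t. i, i.e. k + i = j, impossible since j ≤ m ≤ i < k + i.  Conversely the head
-- t of [t|us] must be the j ≤ m at position i + 1 − j of cs; by distinctness of
-- up-diagonal numbers there is at most one such j, and a bounded search finds it
-- (any ground t works if there is none).
module Submission where

open import Defs
open import Data.Nat as ℕ using (ℕ; zero; suc; _≤_; _<_; _∸_; _≤?_; z≤n; s≤s)
import Data.Nat.Properties as ℕP
open import Data.Integer as ℤ using (ℤ; +_; 1ℤ)
import Data.Integer.Properties as ℤP
open import Data.Integer.Tactic.RingSolver using (solve-∀)
open import Data.Product using (∃; _×_; _,_)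
open import Data.Empty using (⊥-elim)
open import Relation.Nullary using (Dec; yes; no)
open import Relation.Nullary.Decidable using (map′; _×-dec_)
open import Relation.Binary.PropositionalEquality

sucℤ-injective : ∀ {x y} → ℤ.suc x ≡ ℤ.suc y → x ≡ y
sucℤ-injective {x} {y} eq =
  trans (sym (ℤP.pred-suc x)) (trans (cong ℤ.pred eq) (ℤP.pred-suc y))

[+m]-[+n]≡1⇒m≡1+n : ∀ {m n} → + m ℤ.- + n ≡ + 1 → m ≡ suc n
[+m]-[+n]≡1⇒m≡1+n {m} {n} eq = ℤP.+-injective (begin
  + m                    ≡⟨ x≡[x-y]+y (+ m) (+ n) ⟩
  (+ m ℤ.- + n) ℤ.+ + n  ≡⟨ cong (ℤ._+ + n) eq ⟩
  + suc n                ∎)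
  where
  open ≡-Reasoning
  x≡[x-y]+y : ∀ x y → x ≡ (x ℤ.- y) ℤ.+ y
  x≡[x-y]+y = solve-∀

[+1+n]-[+n]≡1 : ∀ n → + suc n ℤ.- + n ≡ + 1
[+1+n]-[+n]≡1 n = [1+x]-x≡1 (+ n)
  where
  [1+x]-x≡1 : ∀ x → (1ℤ ℤ.+ x) ℤ.- x ≡ 1ℤ
  [1+x]-x≡1 = solve-∀

Diagonal : Set
Diagonal = ℕ → ℕ → ℤ

up down : ℕ → Diagonal
up   i k j = upDiag k j i
down i k j = downDiag k j i

_≗1+_ : Diagonal → Diagonal → Set
D ≗1+ D′ = ∀ k j → D k j ≡ ℤ.suc (D′ k j)

up-≗1+ : ∀ i → up i ≗1+ up (suc i)
up-≗1+ i k j = x-y≡1+[x-[1+y]] (+ k ℤ.+ + j) (+ i)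
  where
  x-y≡1+[x-[1+y]] : ∀ x y → x ℤ.- y ≡ 1ℤ ℤ.+ (x ℤ.- (1ℤ ℤ.+ y))
  x-y≡1+[x-[1+y]] = solve-∀

down-≗1+ : ∀ i → down (suc i) ≗1+ down i
down-≗1+ i k j = [x+[1+y]]-z≡1+[[x+y]-z] (+ k) (+ i) (+ j)
  where
  [x+[1+y]]-z≡1+[[x+y]-z] : ∀ x y z → (x ℤ.+ (1ℤ ℤ.+ y)) ℤ.- z ≡ 1ℤ ℤ.+ ((x ℤ.+ y) ℤ.- z)
  [x+[1+y]]-z≡1+[[x+y]-z] = solve-∀

upDiag≡1⇒ : ∀ {k j i} → upDiag k j i ≡ + 1 → k ≡ suc i ∸ j
upDiag≡1⇒ {k} {j} eq = trans (sym (ℕP.m+n∸n≡m k j)) (cong (_∸ j) ([+m]-[+n]≡1⇒m≡1+n eq))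

upDiag[1+i∸j]≡1 : ∀ {j i} → j ≤ suc i → upDiag (suc i ∸ j) j i ≡ + 1
upDiag[1+i∸j]≡1 {j} {i} j≤1+i =
  trans (cong (λ n → + n ℤ.- + i) (ℕP.m∸n+n≡m j≤1+i)) ([+1+n]-[+n]≡1 i)

downDiag-suc≢1 : ∀ {k j i} → 1 ≤ k → j ≤ i → downDiag k j (suc i) ≢ + 1
downDiag-suc≢1 {k} {j} {i} 1≤k j≤i eq = ℕP.<⇒≢ j+1<k+[1+i] (sym ([+m]-[+n]≡1⇒m≡1+n eq))
  where
  j+1<k+[1+i] : suc j < k ℕ.+ suc i
  j+1<k+[1+i] = ℕP.+-mono-≤ 1≤k (s≤s j≤i)

module _ {F : Set} where

  num-ground : ∀ j → Ground {F} (num j)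
  num-ground zero    = g-zro
  num-ground (suc j) = g-sc (num-ground j)

  ≟-num : ∀ j (t : Term F) → Dec (t ≡ num j)
  ≟-num zero    zro        = yes refl
  ≟-num zero    (sc _)     = no λ ()
  ≟-num zero    (var _)    = no λ ()
  ≟-num zero    nil        = no λ ()
  ≟-num zero    (cons _ _) = no λ ()
  ≟-num zero    (app _ _)  = no λ ()
  ≟-num (suc j) (sc t)     = map′ (cong sc) (λ { refl → refl }) (≟-num j t)
  ≟-num (suc _) zro        = no λ ()
  ≟-num (suc _) (var _)    = no λ ()
  ≟-num (suc _) nil        = no λ ()
  ≟-num (suc _) (cons _ _) = no λ ()
  ≟-num (suc _) (app _ _)  = no λ ()

  kthMember? : ∀ {x : Term F} → (∀ e → Dec (e ≡ x)) → ∀ k t → Dec (KthMember k x t)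
  kthMember? x? zero          _          = no λ ()
  kthMember? x? (suc zero)    (cons e _) = map′ (λ { refl → here }) (λ { here → refl }) (x? e)
  kthMember? x? (suc (suc k)) (cons _ t) = map′ there (λ { (there p) → p }) (kthMember? x? (suc k) t)
  kthMember? x? _             (var _)    = no λ ()
  kthMember? x? _             zro        = no λ ()
  kthMember? x? _             (sc _)     = no λ ()
  kthMember? x? _             nil        = no λ ()
  kthMember? x? _             (app _ _)  = no λ ()

  kthMember-pos : ∀ {k} {e t : Term F} → KthMember k e t → 1 ≤ k
  kthMember-pos here      = s≤s z≤n
  kthMember-pos (there _) = s≤s z≤n

  DiagDistinct : Diagonal → ℕ → Term F → Set
  DiagDistinct D m cs = ∀ j₁ j₂ k₁ k₂ → 1 ≤ j₁ → j₁ ≤ m → 1 ≤ j₂ → j₂ ≤ m → j₁ ≢ j₂ →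
    KthMember k₁ (num j₁) cs → KthMember k₂ (num j₂) cs → D k₁ j₁ ≢ D k₂ j₂

  Placed : Diagonal → ℕ → Term F → Term F → Set
  Placed D m cs xs = ∀ j k l → 1 ≤ j → j ≤ m → KthMember k (num j) cs →
    0 < l → + l ≡ D k j → KthMember l (num j) xs

  PlacedFirst : Diagonal → ℕ → Term F → Term F → Set
  PlacedFirst D m cs x = ∀ j k → 1 ≤ j → j ≤ m → KthMember k (num j) cs →
    D k j ≡ + 1 → x ≡ num j

  module _ {D D′ : Diagonal} {m : ℕ} {cs : Term F} (D≗1+D′ : D ≗1+ D′) where

    diagDistinct-unshift : DiagDistinct D m cs → DiagDistinct D′ m cs
    diagDistinct-unshift dd j₁ j₂ k₁ k₂ a₁ b₁ a₂ b₂ ne p₁ p₂ eq =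
      dd j₁ j₂ k₁ k₂ a₁ b₁ a₂ b₂ ne p₁ p₂
        (trans (D≗1+D′ k₁ j₁) (trans (cong ℤ.suc eq) (sym (D≗1+D′ k₂ j₂))))

    diagDistinct-shift : DiagDistinct D′ m cs → DiagDistinct D m cs
    diagDistinct-shift dd j₁ j₂ k₁ k₂ a₁ b₁ a₂ b₂ ne p₁ p₂ eq =
      dd j₁ j₂ k₁ k₂ a₁ b₁ a₂ b₂ ne p₁ p₂
        (sucℤ-injective (trans (sym (D≗1+D′ k₁ j₁)) (trans eq (D≗1+D′ k₂ j₂))))

    placed-tail : ∀ {x xs} → Placed D m cs (cons x xs) → Placed D′ m cs xs
    placed-tail pl j k (suc l) a b p _ eq
      with pl j k (suc (suc l)) a b p (s≤s z≤n) (trans (cong ℤ.suc eq) (sym (D≗1+D′ k j)))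
    ... | there q = q

    placed-cons : ∀ {x xs} → PlacedFirst D m cs x → Placed D′ m cs xs →
                  Placed D m cs (cons x xs)
    placed-cons {x} {xs} first _ j k (suc zero) a b p _ eq =
      subst (λ y → KthMember 1 (num j) (cons y xs)) (sym (first j k a b p (sym eq))) here
    placed-cons first pl j k (suc (suc l)) a b p _ eq =
      there (pl j k (suc l) a b p (s≤s z≤n) (sucℤ-injective (trans eq (D≗1+D′ k j))))

  placedFirst-exists : ∀ {m i} {cs : Term F} → m ≤ i → DiagDistinct (up i) m cs →
                       ∃ λ t → Ground t × PlacedFirst (up i) m cs t
  placedFirst-exists {m} {i} {cs} m≤i dd
    with ℕP.anyUpTo? (λ j → 1 ≤? j ×-dec kthMember? (≟-num j) (suc i ∸ j) cs) (suc m)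
  ... | yes (j₀ , s≤s j₀≤m , 1≤j₀ , p₀) = num j₀ , num-ground j₀ , first
    where
    first : PlacedFirst (up i) m cs (num j₀)
    first j k 1≤j j≤m p eq with j ℕP.≟ j₀
    ... | yes refl = refl
    ... | no j≢j₀  = ⊥-elim (dd j j₀ k (suc i ∸ j₀) 1≤j j≤m 1≤j₀ j₀≤m j≢j₀ p p₀
                       (trans eq (sym (upDiag[1+i∸j]≡1 (ℕP.m≤n⇒m≤1+n (ℕP.≤-trans j₀≤m m≤i))))))
  ... | no none = zro , g-zro , λ j k 1≤j j≤m p eq →
    ⊥-elim (none (j , s≤s j≤m , 1≤j , subst (λ k → KthMember k (num j) cs) (upDiag≡1⇒ {k} {j} {i} eq) p))

  module _ {m i : ℕ} {cs us ds : Term F} where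

    correct-suc : ∀ t t′ → Correct m i cs (cons t us) ds → Correct m (suc i) cs us (cons t′ ds)
    correct-suc t t′ C = record
      { m≤i          = ℕP.m≤n⇒m≤1+n C.m≤i
      ; distinct     = C.distinct
      ; members      = C.members
      ; upDistinct   = diagDistinct-unshift (up-≗1+ i) C.upDistinct
      ; downDistinct = diagDistinct-shift (down-≗1+ i) C.downDistinct
      ; upPlaced     = placed-tail (up-≗1+ i) C.upPlaced
      ; downPlaced   = placed-cons (down-≗1+ i) noneFirst C.downPlaced
      }
      where
      module C = Correct C
      noneFirst : PlacedFirst (down (suc i)) m cs t′
      noneFirst j k _ j≤m p eq =
        ⊥-elim (downDiag-suc≢1 (kthMember-pos p) (ℕP.≤-trans j≤m C.m≤i) eq)

    correct-pred : ∀ t t′ → m ≤ i → PlacedFirst (up i) m cs t →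
                   Correct m (suc i) cs us (cons t′ ds) → Correct m i cs (cons t us) ds
    correct-pred t t′ m≤i first C = record
      { m≤i          = m≤i
      ; distinct     = C.distinct
      ; members      = C.members
      ; upDistinct   = diagDistinct-shift (up-≗1+ i) C.upDistinct
      ; downDistinct = diagDistinct-unshift (down-≗1+ i) C.downDistinct
      ; upPlaced     = placed-cons (up-≗1+ i) first C.upPlaced
      ; downPlaced   = placed-tail (down-≗1+ i) C.downPlaced
      }
      where module C = Correct C

lemma3 : (F : Set) (m i : ℕ) → 0 < m → m ≤ i → (cs us ds : Term F) →
    ((t t' : Term F) → Ground t → Ground t' →
      Correct m i cs (cons t us) ds → Correct m (suc i) cs us (cons t' ds))
    × ((t' : Term F) → Ground t' →
      Correct m (suc i) cs us (cons t' ds) →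
      ∃ λ t → Ground t × Correct m i cs (cons t us) ds)
lemma3 F m i _ m≤i cs us ds =
  (λ t t′ _ _ → correct-suc t t′) ,
  λ t′ _ C →
    let upDistinct = diagDistinct-shift (up-≗1+ i) (Correct.upDistinct C)
        (t , ground , first) = placedFirst-exists m≤i upDistinct
    in t , ground , correct-pred t t′ m≤i first C
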